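{- Let $n$ and $m$ be positive integers with $m\geq n+1$. For every integer $r$ with $1\leq r\leq m-1$, the number of $(n,m)$-lattice paths $P$ with $RML(P)=r$ equals the number of $(n,m)$-lattice paths $P=(x_1,y_1)(x_2,y_2)\cdots(x_{n+1},y_{n+1})$ with $RML(P)=0$ and $x_{n+1}=1$; in particular it is independent of $r$.
   Context: An $(n,m)$-lattice path is a sequence $P=(x_1,y_1)(x_2,y_2)\cdots(x_{n+1},y_{n+1})$ of vectors in $\mathbb{Z}^2$ such that $1-n\leq y_i\leq 1$ for all $i$, $\sum_{i=1}^{n+1}y_i=1$, $1\leq x_i\leq m-1$ for all $i$, and $\sum_{i=1}^{n+1}x_i=m$. For such $P$ put $a_0=b_0=0$, $a_i=\sum_{j=1}^{i}y_j$ and $b_i=\sum_{j=1}^{i}x_j$ for $1\leq i\leq n+1$, and view $P$ as the sequence of points $(b_0,a_0),\ldots,(b_{n+1},a_{n+1})$. A minimum point of $P$ is a point $(b_i,a_i)$ with $a_i\leq a_j$ for all $j\in\{0,\ldots,n+1\}$; the rightmost minimum point is the minimum point with the largest $b_i$. If $(b_i,a_i)$ is the rightmost minimum point, $RML(P)=b_i$ is the rightmost minimum length of $P$. -}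

module Defs where

open import Data.Nat as ℕ using (ℕ; zero; suc; _∸_; _⊔_)
open import Data.Integer as ℤ using (ℤ; +_; _⊓_)
open import Data.Product using (_×_; _,_; proj₁; proj₂; Σ; ∃)
open import Data.List using (List; []; _∷_; foldr; map; filter)
open import Data.Vec using (Vec; []; _∷_; last)
open import Data.Vec.Relation.Unary.All using (All)
open import Data.Fin using (Fin)
open import Relation.Binary.PropositionalEquality using (_≡_)
open import Function.Bundles using (_↔_)

Step : Set
Step = ℕ × ℤ

sumX : ∀ {k} → Vec Step k → ℕ
sumX [] = 0
sumX ((x , _) ∷ s) = x ℕ.+ sumX s

sumY : ∀ {k} → Vec Step k → ℤ
sumY [] = + 0
sumY ((_ , y) ∷ s) = y ℤ.+ sumY s

StepOK : ℕ → ℕ → Step → Set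
StepOK n m (x , y) = (1 ℕ.≤ x × x ℕ.≤ m ∸ 1) × ((+ 1 ℤ.- + n) ℤ.≤ y × y ℤ.≤ + 1)

IsLatticePath : (n m : ℕ) → Vec Step (suc n) → Set
IsLatticePath n m P = All (StepOK n m) P × sumY P ≡ + 1 × sumX P ≡ m

pointsFrom : ∀ {k} → ℕ → ℤ → Vec Step k → List (ℕ × ℤ)
pointsFrom b a [] = (b , a) ∷ []
pointsFrom b a ((x , y) ∷ s) = (b , a) ∷ pointsFrom (b ℕ.+ x) (a ℤ.+ y) s

points : ∀ {k} → Vec Step k → List (ℕ × ℤ)
points = pointsFrom 0 (+ 0)

-- minimal height among all points (the point (0,0) is always among them)
minHeight : List (ℕ × ℤ) → ℤ
minHeight = foldr (λ p acc → proj₂ p ⊓ acc) (+ 0)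

RML : ∀ {k} → Vec Step k → ℕ
RML P = foldr _⊔_ 0 (map proj₁ (filter (λ p → proj₂ p ℤ.≟ minHeight (points P)) (points P)))

HasCard : Set → ℕ → Set
HasCard A k = A ↔ Fin k

-- Cut a path P with RML(P) = r at its rightmost minimum, P = U W, and rotate it to W U.
-- Since the total rise is 1, every point of W U after the start lies strictly above it
-- (the cycle lemma), so RML(W U) = 0, and W has width m - r.  To make the rotation
-- invertible, the last run of W and the first run of U are fused into a single run one
-- shorter than their sum, and a run of 1 is appended.  Conversely, from a path with
-- RML 0 ending in a run of 1, drop that run, split the run in which the width m - r is
-- reached, and rotate back; the cycle lemma read backwards shows that the cut now sits at
-- the rightmost minimum, so the two maps are mutually inverse.

module Submission where

open import Defs
open import Data.Nat using (ℕ; suc; _≤_; _∸_; _+_)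
open import Data.Product using (Σ; ∃; _×_; proj₁)
open import Data.Vec using (Vec; last)
open import Relation.Binary.PropositionalEquality using (_≡_)

open import Axiom.UniquenessOfIdentityProofs using (module Decidable⇒UIP)
open import Data.Empty using (⊥-elim)
open import Data.Fin using (Fin; zero; suc; toℕ; fromℕ<)
import Data.Fin.Properties as Fin
open import Data.Integer as ℤ using (ℤ; +_; -[1+_])
import Data.Integer.Properties as ℤ
open import Algebra.Properties.CommutativeSemigroup ℤ.+-commutativeSemigroup using (xy∙z≈xz∙y)
open import Algebra.Properties.AbelianGroup ℤ.+-0-abelianGroup using (xyx⁻¹≈y)
open import Data.List as List using (List; []; _∷_; _++_; length; map; foldr; filter; zip)
import Data.List.Properties as List
open import Data.List.Membership.Propositional using (_∈_)
open import Data.List.Relation.Unary.All as All using (All; []; _∷_)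
import Data.List.Relation.Unary.All.Properties as All
open import Data.List.Relation.Unary.Any using (here; there)
open import Data.Maybe as Maybe using (Maybe; just)
import Data.Maybe.Properties as Maybe
open import Data.Nat as ℕ using (zero; _<_; _⊔_; z≤n; s≤s; pred; _≤?_)
import Data.Nat.Properties as ℕ
open import Data.Nat.ListAction using (sum)
open import Data.Nat.ListAction.Properties using (sum-++)
import Data.Product as Product
open import Data.Product using (_,_; proj₂; ∃₂)
open import Data.Product.Function.NonDependent.Propositional using (_×-↔_)
open import Data.Product.Properties using (Σ-≡,≡→≡)
open import Data.Sum using (_⊎_; inj₁; inj₂)
open import Data.Sum.Function.Propositional using (_⊎-↔_)
open import Data.Unit using (⊤; tt)
import Data.Vec as Vec
open import Data.Vec using ([]; _∷_; toList)
import Data.Vec.Properties as Vec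
import Data.Vec.Relation.Unary.All as VecAll
import Data.Vec.Relation.Unary.All.Properties as VecAll
open import Function using (_∘_; id)
open import Function.Bundles using (_↔_; mk↔ₛ′; Inverse)
open import Function.Properties.Inverse using (↔-sym; ↔-trans)
open import Relation.Binary.PropositionalEquality using (refl; sym; trans; cong; cong₂; subst; module ≡-Reasoning)
open import Relation.Nullary using (Dec; yes; no; ¬_)
import Relation.Nullary as Nullary
open import Relation.Nullary.Decidable using (_×-dec_)
open import Relation.Unary using (Decidable; Irrelevant)

open ≡-Reasoning

map-++⁻ : ∀ {A B : Set} (f : A → B) L {X Y} → map f L ≡ X ++ Y →
          ∃₂ λ U W → L ≡ U ++ W × map f U ≡ X × map f W ≡ Y
map-++⁻ f L {[]} refl = [] , L , refl , refl , refl
map-++⁻ f (s ∷ L) {x ∷ X} eq with map-++⁻ f L {X} (List.∷-injectiveʳ eq)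
... | U , W , refl , refl , refl = s ∷ U , W , refl , cong (_∷ map f U) (List.∷-injectiveˡ eq) , refl

init : ∀ {A : Set} → List A → List A
init [] = []
init (x ∷ []) = []
init (x ∷ y ∷ xs) = x ∷ init (y ∷ xs)

init-∷ʳ : ∀ {A : Set} (xs : List A) x → init (xs ++ x ∷ []) ≡ xs
init-∷ʳ [] x = refl
init-∷ʳ (y ∷ []) x = refl
init-∷ʳ (y ∷ z ∷ xs) x = cong (y ∷_) (init-∷ʳ (z ∷ xs) x)

init-∷ʳ-last : ∀ {A : Set} (xs : List A) {x} → List.last xs ≡ just x → init xs ++ x ∷ [] ≡ xs
init-∷ʳ-last (y ∷ []) refl = refl
init-∷ʳ-last (y ∷ z ∷ xs) eq = cong (y ∷_) (init-∷ʳ-last (z ∷ xs) eq)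

last-∷ʳ : ∀ {A : Set} (xs : List A) x → List.last (xs ++ x ∷ []) ≡ just x
last-∷ʳ [] x = refl
last-∷ʳ (y ∷ []) x = refl
last-∷ʳ (y ∷ z ∷ xs) x = last-∷ʳ (z ∷ xs) x

-- Walks, given by their lists of vertical steps

sumℤ : List ℤ → ℤ
sumℤ = foldr ℤ._+_ (+ 0)

sumℤ-++ : ∀ U W → sumℤ (U ++ W) ≡ sumℤ U ℤ.+ sumℤ W
sumℤ-++ [] W = sym (ℤ.+-identityˡ (sumℤ W))
sumℤ-++ (y ∷ U) W = trans (cong (λ s → y ℤ.+ s) (sumℤ-++ U W)) (sym (ℤ.+-assoc y (sumℤ U) (sumℤ W)))

endHeight : ℤ → List ℤ → ℤ
endHeight h [] = h
endHeight h (y ∷ Y) = endHeight (h ℤ.+ y) Y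

endHeight-from-0 : ∀ Y → endHeight (+ 0) Y ≡ sumℤ Y
endHeight-from-0 Y = trans (endHeight≡+sumℤ (+ 0) Y) (ℤ.+-identityˡ (sumℤ Y))
  where
  endHeight≡+sumℤ : ∀ h Y → endHeight h Y ≡ h ℤ.+ sumℤ Y
  endHeight≡+sumℤ h [] = sym (ℤ.+-identityʳ h)
  endHeight≡+sumℤ h (y ∷ Y) = trans (endHeight≡+sumℤ (h ℤ.+ y) Y) (ℤ.+-assoc h y (sumℤ Y))

-- Walks start at height h and are compared with a threshold t; only NeverBelow constrains the start.
NeverBelow : ℤ → ℤ → List ℤ → Set
NeverBelow t h [] = t ℤ.≤ h
NeverBelow t h (y ∷ Y) = t ℤ.≤ h × NeverBelow t (h ℤ.+ y) Y

StaysAbove : ℤ → ℤ → List ℤ → Set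
StaysAbove t h [] = ⊤
StaysAbove t h (y ∷ Y) = t ℤ.< h ℤ.+ y × StaysAbove t (h ℤ.+ y) Y

NeverBelow-head : ∀ {t h} Y → NeverBelow t h Y → t ℤ.≤ h
NeverBelow-head [] t≤h = t≤h
NeverBelow-head (_ ∷ _) (t≤h , _) = t≤h

StaysAbove-end : ∀ {t h} y Y → StaysAbove t h (y ∷ Y) → t ℤ.< endHeight h (y ∷ Y)
StaysAbove-end y [] (t<h , _) = t<h
StaysAbove-end {h = h} y (y′ ∷ Y) (_ , Y>) = StaysAbove-end {h = h ℤ.+ y} y′ Y Y>

NeverBelow⇒StaysAbove : ∀ {s t h} Y → s ℤ.< t → NeverBelow t h Y → StaysAbove s h Y
NeverBelow⇒StaysAbove [] s<t _ = tt
NeverBelow⇒StaysAbove (y ∷ Y) s<t (_ , Y≥) =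
  ℤ.<-≤-trans s<t (NeverBelow-head Y Y≥) , NeverBelow⇒StaysAbove Y s<t Y≥

StaysAbove⇒NeverBelow : ∀ {t h} Y → t ℤ.< h → StaysAbove t h Y → NeverBelow (ℤ.suc t) h Y
StaysAbove⇒NeverBelow [] t<h _ = ℤ.i<j⇒suc[i]≤j t<h
StaysAbove⇒NeverBelow (y ∷ Y) t<h (t<h′ , Y>) = ℤ.i<j⇒suc[i]≤j t<h , StaysAbove⇒NeverBelow Y t<h′ Y>

StaysAbove-mono : ∀ {s t h} Y → s ℤ.< t → StaysAbove t h Y → StaysAbove s h Y
StaysAbove-mono [] s<t _ = tt
StaysAbove-mono (y ∷ Y) s<t (t<h , Y>) = ℤ.<-trans s<t t<h , StaysAbove-mono Y s<t Y>

StaysAbove-++⁺ : ∀ {t h} U W → StaysAbove t h U → StaysAbove t (endHeight h U) W →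
                 StaysAbove t h (U ++ W)
StaysAbove-++⁺ [] W _ W> = W>
StaysAbove-++⁺ (y ∷ U) W (t<h , U>) W> = t<h , StaysAbove-++⁺ U W U> W>

StaysAbove-++⁻ : ∀ {t h} U W → StaysAbove t h (U ++ W) →
                 StaysAbove t h U × StaysAbove t (endHeight h U) W
StaysAbove-++⁻ [] W W> = tt , W>
StaysAbove-++⁻ (y ∷ U) W (t<h , UW>) = let U> , W> = StaysAbove-++⁻ U W UW> in (t<h , U>) , W>

NeverBelow-shift : ∀ {d t h t′ h′} Y → t ℤ.+ d ≡ t′ → h ℤ.+ d ≡ h′ →
                   NeverBelow t h Y → NeverBelow t′ h′ Y
NeverBelow-shift {d} [] refl refl t≤h = ℤ.+-monoˡ-≤ d t≤h
NeverBelow-shift {d} {h = h} (y ∷ Y) refl refl (t≤h , Y≥) =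
  ℤ.+-monoˡ-≤ d t≤h , NeverBelow-shift Y refl (xy∙z≈xz∙y h y d) Y≥

StaysAbove-shift : ∀ {d t h t′ h′} Y → t ℤ.+ d ≡ t′ → h ℤ.+ d ≡ h′ →
                   StaysAbove t h Y → StaysAbove t′ h′ Y
StaysAbove-shift [] _ _ _ = tt
StaysAbove-shift {d} {h = h} (y ∷ Y) refl refl (t<h , Y>) =
  subst (_ ℤ.<_) (xy∙z≈xz∙y h y d) (ℤ.+-monoˡ-< d t<h) , StaysAbove-shift Y refl (xy∙z≈xz∙y h y d) Y>

-- U ends at the rightmost minimum of the walk U ++ W started at height h.
MinSplit : ℤ → List ℤ → List ℤ → Set
MinSplit h U W = NeverBelow (endHeight h U) h U × StaysAbove (endHeight h U) (endHeight h U) W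

minSplit : ∀ h Y → ∃₂ λ U W → U ++ W ≡ Y × MinSplit h U W
minSplit h [] = [] , [] , refl , ℤ.≤-refl , tt
minSplit h (y ∷ Y) with minSplit (h ℤ.+ y) Y
... | U , W , refl , U≥ , W> with endHeight (h ℤ.+ y) U ℤ.≤? h
...   | yes e≤h = y ∷ U , W , refl , (e≤h , U≥) , W>
...   | no  e≰h = [] , y ∷ U ++ W , refl , ℤ.≤-refl ,
                  ℤ.<-≤-trans h<e (NeverBelow-head U U≥) ,
                  StaysAbove-++⁺ U W (NeverBelow⇒StaysAbove U h<e U≥) (StaysAbove-mono W h<e W>)
  where h<e = ℤ.≰⇒> e≰h

-- Cycle lemma: a walk of total rise 1, cut at its rightmost minimum and rotated, stays
-- strictly above its starting height; conversely, such a walk rotated back has its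
-- rightmost minimum at the cut.
StaysAbove-rotate : ∀ U W → MinSplit (+ 0) U W → sumℤ (U ++ W) ≡ + 1 →
                    StaysAbove (+ 0) (+ 0) (W ++ U)
StaysAbove-rotate U W (U≥ , W>) rise≡1 =
  StaysAbove-++⁺ W U (StaysAbove-shift W (ℤ.+-inverseʳ e) (ℤ.+-inverseʳ e) W>)
    (NeverBelow⇒StaysAbove U (ℤ.+<+ (s≤s z≤n)) (NeverBelow-shift U e+w≡1 (ℤ.+-identityˡ w) U≥))
  where
  e = endHeight (+ 0) U
  w = endHeight (+ 0) W
  e+w≡1 : e ℤ.+ w ≡ + 1
  e+w≡1 = begin
    e ℤ.+ w              ≡⟨ cong₂ ℤ._+_ (endHeight-from-0 U) (endHeight-from-0 W) ⟩
    sumℤ U ℤ.+ sumℤ W    ≡⟨ sumℤ-++ U W ⟨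
    sumℤ (U ++ W)        ≡⟨ rise≡1 ⟩
    + 1                  ∎

MinSplit-rotate : ∀ U y W → StaysAbove (+ 0) (+ 0) (y ∷ W ++ U) → sumℤ (y ∷ W ++ U) ≡ + 1 →
                  MinSplit (+ 0) U (y ∷ W)
MinSplit-rotate U y W WU> rise≡1 =
  NeverBelow-shift U 1-w≡e (ℤ.+-inverseʳ w) (StaysAbove⇒NeverBelow U (StaysAbove-end {h = + 0} y W W>) U>) ,
  StaysAbove-shift {d = e} {h = + 0} (y ∷ W) (ℤ.+-identityˡ e) (ℤ.+-identityˡ e) W>
  where
  W> = proj₁ (StaysAbove-++⁻ {h = + 0} (y ∷ W) U WU>)
  U> = proj₂ (StaysAbove-++⁻ {h = + 0} (y ∷ W) U WU>)
  e = endHeight (+ 0) U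
  w = endHeight (+ 0) (y ∷ W)
  1-w≡e : + 1 ℤ.- w ≡ e
  1-w≡e = begin
    + 1 ℤ.- w                      ≡⟨ cong (ℤ._- w) rise≡1 ⟨
    sumℤ (y ∷ W ++ U) ℤ.- w        ≡⟨ cong (ℤ._- w) (sumℤ-++ (y ∷ W) U) ⟩
    sumℤ (y ∷ W) ℤ.+ sumℤ U ℤ.- w  ≡⟨ cong₂ (λ a b → a ℤ.+ b ℤ.- w) (endHeight-from-0 (y ∷ W))
                                                                    (endHeight-from-0 U) ⟨
    w ℤ.+ e ℤ.- w                  ≡⟨ xyx⁻¹≈y w e ⟩
    e                              ∎

-- Compositions

Positive : List ℕ → Set
Positive = All (0 <_)

fuse : ℕ → List ℕ → ℕ → List ℕ → List ℕ
fuse a [] b B = pred a + b ∷ B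
fuse a (a′ ∷ A) b B = a ∷ fuse a′ A b B

split : ℕ → List ℕ → List ℕ
split c [] = []
split c (x ∷ X) with c ≤? x
... | yes _ = c ∷ suc x ∸ c ∷ X
... | no  _ = x ∷ split (c ∸ x) X

split-≤ : ∀ {c x} X → c ≤ x → split c (x ∷ X) ≡ c ∷ suc x ∸ c ∷ X
split-≤ {c} {x} X c≤x with c ≤? x
... | yes _ = refl
... | no c≰x = ⊥-elim (c≰x c≤x)

split-≰ : ∀ {c x} X → ¬ c ≤ x → split c (x ∷ X) ≡ x ∷ split (c ∸ x) X
split-≰ {c} {x} X c≰x with c ≤? x
... | yes c≤x = ⊥-elim (c≰x c≤x)
... | no _ = refl

length-fuse : ∀ a A b B → suc (length (fuse a A b B)) ≡ length (a ∷ A ++ b ∷ B)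
length-fuse a [] b B = refl
length-fuse a (a′ ∷ A) b B = cong suc (length-fuse a′ A b B)

sum-fuse : ∀ a A b B → Positive (a ∷ A) → suc (sum (fuse a A b B)) ≡ sum (a ∷ A ++ b ∷ B)
sum-fuse (suc a) [] b B _ = cong suc (ℕ.+-assoc a b (sum B))
sum-fuse a (a′ ∷ A) b B (_ ∷ A⁺) =
  trans (sym (ℕ.+-suc a _)) (cong (λ s → a + s) (sum-fuse a′ A b B A⁺))

fuse-positive : ∀ a A b B → Positive (a ∷ A ++ b ∷ B) → Positive (fuse a A b B)
fuse-positive a [] b B (_ ∷ 0<b ∷ B⁺) = ℕ.≤-trans 0<b (ℕ.m≤n+m b (pred a)) ∷ B⁺
fuse-positive a (a′ ∷ A) b B (0<a ∷ A⁺) = 0<a ∷ fuse-positive a′ A b B A⁺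

split-fuse : ∀ a A b B → Positive (a ∷ A ++ b ∷ B) →
             split (sum (a ∷ A)) (fuse a A b B) ≡ a ∷ A ++ b ∷ B
split-fuse (suc a) [] b B (_ ∷ 0<b ∷ _)
  rewrite ℕ.+-identityʳ a | split-≤ B (ℕ.m<m+n a 0<b) | ℕ.m+n∸m≡n a b = refl
split-fuse a (a′ ∷ A) b B (_ ∷ A⁺@(0<a′ ∷ _))
  rewrite split-≰ (fuse a′ A b B) (ℕ.<⇒≱ (ℕ.m<m+n a (ℕ.<-≤-trans 0<a′ (ℕ.m≤m+n a′ (sum A)))))
        | ℕ.m+n∸m≡n a (sum (a′ ∷ A)) | split-fuse a′ A b B A⁺ = refl

parts≤sum : ∀ X → All (_≤ sum X) X
parts≤sum [] = []
parts≤sum (x ∷ X) =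
  ℕ.m≤m+n x (sum X) ∷ All.map (λ {y} y≤ → ℕ.≤-trans y≤ (ℕ.m≤n+m (sum X) x)) (parts≤sum X)

parts<sum : ∀ x y X → Positive (x ∷ y ∷ X) → All (_< sum (x ∷ y ∷ X)) (x ∷ y ∷ X)
parts<sum x y X (0<x ∷ 0<y ∷ _) =
  ℕ.m<m+n x (ℕ.<-≤-trans 0<y (ℕ.m≤m+n y (sum X))) ∷
  All.map (λ {z} z≤ → ℕ.≤-<-trans z≤ (ℕ.m<n+m (sum (y ∷ X)) 0<x)) (parts≤sum (y ∷ X))

record Fission (c : ℕ) (X : List ℕ) : Set where
  field
    a : ℕ
    A : List ℕ
    b : ℕ
    B : List ℕ
    split≡ : split c X ≡ a ∷ A ++ b ∷ B
    width≡ : sum (a ∷ A) ≡ c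
    positive : Positive (a ∷ A ++ b ∷ B)
    fuse≡ : fuse a A b B ≡ X

fission : ∀ c X → 0 < c → c ≤ sum X → Positive X → Fission c X
fission c [] 0<c c≤0 [] = ⊥-elim (ℕ.<⇒≱ 0<c c≤0)
fission c (x ∷ X) 0<c c≤ (0<x ∷ X⁺) with c ≤? x
... | yes c≤x = record
  { a = c
  ; A = []
  ; b = suc x ∸ c
  ; B = X
  ; split≡ = split-≤ X c≤x
  ; width≡ = ℕ.+-identityʳ c
  ; positive = 0<c ∷ ℕ.m<n⇒0<n∸m (s≤s c≤x) ∷ X⁺
  ; fuse≡ = cong (_∷ X) (pred+suc∸ 0<c c≤x) }
  where
  pred+suc∸ : ∀ {c x} → 0 < c → c ≤ x → pred c + (suc x ∸ c) ≡ x
  pred+suc∸ {suc c} (s≤s _) c≤x = ℕ.m+[n∸m]≡n (ℕ.≤-trans (ℕ.n≤1+n c) c≤x)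
... | no c≰x = record
  { a = x
  ; A = F.a ∷ F.A
  ; b = F.b
  ; B = F.B
  ; split≡ = trans (split-≰ X c≰x) (cong (x ∷_) F.split≡)
  ; width≡ = trans (cong (λ s → x + s) F.width≡) (ℕ.m+[n∸m]≡n (ℕ.<⇒≤ x<c))
  ; positive = 0<x ∷ F.positive
  ; fuse≡ = cong (x ∷_) F.fuse≡ }
  where
  x<c = ℕ.≰⇒> c≰x
  module F = Fission (fission (c ∸ x) X (ℕ.m<n⇒0<n∸m x<c)
                        (subst (c ∸ x ≤_) (ℕ.m+n∸m≡n x (sum X)) (ℕ.∸-monoˡ-≤ x c≤)) X⁺)

xCoords : List Step → List ℕ
xCoords = map proj₁

yCoords : List Step → List ℤ
yCoords = map proj₂

width : List Step → ℕ
width L = sum (xCoords L)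

xCoords-zip : ∀ X Y → length X ≡ length Y → xCoords (zip X Y) ≡ X
xCoords-zip [] [] _ = refl
xCoords-zip (x ∷ X) (y ∷ Y) eq = cong (x ∷_) (xCoords-zip X Y (ℕ.suc-injective eq))

yCoords-zip : ∀ X Y → length X ≡ length Y → yCoords (zip X Y) ≡ Y
yCoords-zip [] [] _ = refl
yCoords-zip (x ∷ X) (y ∷ Y) eq = cong (y ∷_) (yCoords-zip X Y (ℕ.suc-injective eq))

zip-coords : ∀ L → zip (xCoords L) (yCoords L) ≡ L
zip-coords [] = refl
zip-coords (s ∷ L) = cong (s ∷_) (zip-coords L)

cutAt : ℕ → List Step → List Step × List Step
cutAt zero L = [] , L
cutAt (suc c) [] = [] , []
cutAt (suc c) (s ∷ L) = Product.map₁ (s ∷_) (cutAt (suc c ∸ proj₁ s) L)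

cutAt-++ : ∀ U W → Positive (xCoords U) → cutAt (width U) (U ++ W) ≡ (U , W)
cutAt-++ [] W _ = refl
cutAt-++ ((suc x , y) ∷ U) W (_ ∷ U⁺) rewrite ℕ.m+n∸m≡n x (width U) | cutAt-++ U W U⁺ = refl

rise : List Step → ℤ
rise L = sumℤ (yCoords L)

rise-swap : ∀ U W → rise (U ++ W) ≡ rise (W ++ U)
rise-swap U W = begin
  sumℤ (yCoords (U ++ W))             ≡⟨ cong sumℤ (List.map-++ proj₂ U W) ⟩
  sumℤ (yCoords U ++ yCoords W)       ≡⟨ sumℤ-++ (yCoords U) (yCoords W) ⟩
  rise U ℤ.+ rise W                   ≡⟨ ℤ.+-comm (rise U) (rise W) ⟩
  rise W ℤ.+ rise U                   ≡⟨ sumℤ-++ (yCoords W) (yCoords U) ⟨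
  sumℤ (yCoords W ++ yCoords U)       ≡⟨ cong sumℤ (List.map-++ proj₂ W U) ⟨
  sumℤ (yCoords (W ++ U))             ∎

width-++ : ∀ U W → width (U ++ W) ≡ width U + width W
width-++ U W = trans (cong sum (List.map-++ proj₁ U W)) (sum-++ (xCoords U) (xCoords W))

width-swap : ∀ U W → width (U ++ W) ≡ width (W ++ U)
width-swap U W = trans (width-++ U W) (trans (ℕ.+-comm (width U) (width W)) (sym (width-++ W U)))

ValidRun : ℕ → ℕ → Set
ValidRun m x = 1 ≤ x × x ≤ m ∸ 1

ValidRise : ℕ → ℤ → Set
ValidRise n y = (+ 1 ℤ.- + n) ℤ.≤ y × y ℤ.≤ + 1

IsLatticePathᴸ : ℕ → ℕ → List Step → Set
IsLatticePathᴸ n m L = length L ≡ suc n × All (StepOK n m) L × rise L ≡ + 1 × width L ≡ m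

IsLatticePathᴸ-swap : ∀ {n m} U W → IsLatticePathᴸ n m (U ++ W) → IsLatticePathᴸ n m (W ++ U)
IsLatticePathᴸ-swap U W (len , ok , rise≡ , width≡) =
  trans (List.length-++-comm W U) len ,
  All.++⁺ (All.++⁻ʳ U ok) (All.++⁻ˡ U ok) ,
  trans (rise-swap W U) rise≡ ,
  trans (width-swap W U) width≡

coords-valid : ∀ {n m} L → All (StepOK n m) L → All (ValidRun m) (xCoords L) × All (ValidRise n) (yCoords L)
coords-valid L ok = Product.map All.map⁺ All.map⁺ (All.unzip ok)

parts-ValidRun : ∀ {m} X → 2 ≤ length X → Positive X → sum X ≡ m → All (ValidRun m) X
parts-ValidRun (x ∷ []) (s≤s ()) _ _
parts-ValidRun (x ∷ x′ ∷ X) _ X⁺ refl =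
  All.zipWith (λ (0<z , z<) → 0<z , ℕ.<⇒≤pred z<) (X⁺ , parts<sum x x′ X X⁺)

-- With at least two positive runs, the bound x ≤ m - 1 of StepOK is implied by width L ≡ m.
IsLatticePathᴸ-intro : ∀ {n m} L → 1 ≤ n → length L ≡ suc n → Positive (xCoords L) → width L ≡ m →
                       All (ValidRise n) (yCoords L) → rise L ≡ + 1 → IsLatticePathᴸ n m L
IsLatticePathᴸ-intro L 1≤n len L⁺ width≡ rises rise≡ =
  len , All.zip (All.map⁻ runs , All.map⁻ rises) , rise≡ , width≡
  where
  runs = parts-ValidRun (xCoords L) (subst (2 ≤_) (sym (trans (List.length-map proj₁ L) len)) (s≤s 1≤n))
                        L⁺ width≡

-- The rightmost minimum

_⊑_ : ℕ × ℤ → ℕ × ℤ → Set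
(b , a) ⊑ (b′ , a′) = a′ ℤ.≤ a × (a ≡ a′ → b ℕ.≤ b′)

-- minHeight starts its fold at height 0, hence the hypothesis e ≤ 0.
minHeight-unique : ∀ {b e} ps → e ℤ.≤ + 0 → (b , e) ∈ ps → All (_⊑ (b , e)) ps → minHeight ps ≡ e
minHeight-unique {b} {e} ps e≤0 q∈ps ps⊑q = ℤ.≤-antisym (minHeight≤ ps q∈ps) (≤minHeight ps ps⊑q)
  where
  minHeight≤ : ∀ ps → (b , e) ∈ ps → minHeight ps ℤ.≤ e
  minHeight≤ (_ ∷ ps) (here refl) = ℤ.i⊓j≤i e (minHeight ps)
  minHeight≤ (p ∷ ps) (there q∈ps) =
    ℤ.≤-trans (ℤ.i⊓j≤j (proj₂ p) (minHeight ps)) (minHeight≤ ps q∈ps)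

  ≤minHeight : ∀ ps → All (_⊑ (b , e)) ps → e ℤ.≤ minHeight ps
  ≤minHeight [] [] = e≤0
  ≤minHeight (p ∷ ps) ((e≤ , _) ∷ ps⊑q) = ℤ.⊓-glb e≤ (≤minHeight ps ps⊑q)

rightmostAt : ℤ → List (ℕ × ℤ) → ℕ
rightmostAt e ps = foldr _⊔_ 0 (map proj₁ (filter (λ p → proj₂ p ℤ.≟ e) ps))

rightmostAt-unique : ∀ {b e} ps → (b , e) ∈ ps → All (_⊑ (b , e)) ps → rightmostAt e ps ≡ b
rightmostAt-unique {b} {e} ps q∈ps ps⊑q = ℕ.≤-antisym (rightmostAt≤ ps ps⊑q) (≤rightmostAt ps q∈ps)
  where
  rightmostAt≤ : ∀ ps → All (_⊑ (b , e)) ps → rightmostAt e ps ℕ.≤ b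
  rightmostAt≤ [] [] = z≤n
  rightmostAt≤ (p ∷ ps) ((_ , ≤b) ∷ ps⊑q) with proj₂ p ℤ.≟ e
  ... | yes p≡e = ℕ.⊔-lub (≤b p≡e) (rightmostAt≤ ps ps⊑q)
  ... | no _ = rightmostAt≤ ps ps⊑q

  ≤rightmostAt : ∀ ps → (b , e) ∈ ps → b ℕ.≤ rightmostAt e ps
  ≤rightmostAt (p ∷ ps) (here refl) with e ℤ.≟ e
  ... | yes _ = ℕ.m≤m⊔n b _
  ... | no e≢e = ⊥-elim (e≢e refl)
  ≤rightmostAt (p ∷ ps) (there q∈ps) with proj₂ p ℤ.≟ e
  ... | yes _ = ℕ.≤-trans (≤rightmostAt ps q∈ps) (ℕ.m≤n⊔m (proj₁ p) _)
  ... | no _ = ≤rightmostAt ps q∈ps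

RML-unique : ∀ {k b e} (v : Vec Step k) → e ℤ.≤ + 0 → (b , e) ∈ points v → All (_⊑ (b , e)) (points v) →
             RML v ≡ b
RML-unique v e≤0 q∈ps ps⊑q rewrite minHeight-unique (points v) e≤0 q∈ps ps⊑q =
  rightmostAt-unique (points v) q∈ps ps⊑q

start∈pointsFrom : ∀ {k} b a (v : Vec Step k) → (b , a) ∈ pointsFrom b a v
start∈pointsFrom b a [] = here refl
start∈pointsFrom b a (_ ∷ _) = here refl

pointsFrom-⊑ : ∀ {q} b h W → (b , h) ⊑ q → StaysAbove (proj₂ q) h (yCoords W) →
               All (_⊑ q) (pointsFrom b h (Vec.fromList W))
pointsFrom-⊑ b h [] bh⊑q _ = bh⊑q ∷ []
pointsFrom-⊑ b h ((x , y) ∷ W) bh⊑q (t<h+y , W>) =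
  bh⊑q ∷ pointsFrom-⊑ (b + x) (h ℤ.+ y) W (ℤ.<⇒≤ t<h+y , ⊥-elim ∘ ℤ.<⇒≢ t<h+y ∘ sym) W>

rightmostMinimum : ∀ {bs} b a U W → b + width U ≡ bs → MinSplit a (yCoords U) (yCoords W) →
                   let q = (bs , endHeight a (yCoords U)); ps = pointsFrom b a (Vec.fromList (U ++ W))
                   in q ∈ ps × All (_⊑ q) ps
rightmostMinimum b a [] W refl (_ , W>) =
  subst (λ c → (c , a) ∈ pointsFrom b a (Vec.fromList W)) (sym (ℕ.+-identityʳ b))
        (start∈pointsFrom b a (Vec.fromList W)) ,
  pointsFrom-⊑ b a W (ℤ.≤-refl , λ _ → ℕ.m≤m+n b 0) W>
rightmostMinimum b a ((x , y) ∷ U) W refl ((e≤a , U≥) , W>) =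
  let q∈ , ⊑q = rightmostMinimum (b + x) (a ℤ.+ y) U W (ℕ.+-assoc b x (width U)) (U≥ , W>)
  in there q∈ , (e≤a , λ _ → ℕ.m≤m+n b _) ∷ ⊑q

MinSplit⇒RML≡width : ∀ U W → MinSplit (+ 0) (yCoords U) (yCoords W) →
                     RML (Vec.fromList (U ++ W)) ≡ width U
MinSplit⇒RML≡width U W atMin@(U≥ , _) =
  let q∈ , ⊑q = rightmostMinimum 0 (+ 0) U W refl atMin
  in RML-unique (Vec.fromList (U ++ W)) (NeverBelow-head (yCoords U) U≥) q∈ ⊑q

minSplitᴸ : ∀ L → ∃₂ λ U W → L ≡ U ++ W × MinSplit (+ 0) (yCoords U) (yCoords W)
minSplitᴸ L with minSplit (+ 0) (yCoords L)
... | YU , _ , Y≡ , atMin with map-++⁻ proj₂ L {YU} (sym Y≡)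
...   | U , W , L≡ , refl , refl = U , W , L≡ , atMin

StaysAbove⇒RML≡0 : ∀ L → StaysAbove (+ 0) (+ 0) (yCoords L) → RML (Vec.fromList L) ≡ 0
StaysAbove⇒RML≡0 L L> = MinSplit⇒RML≡width [] L (ℤ.≤-refl , L>)

RML≡0⇒StaysAbove : ∀ L → Positive (xCoords L) → RML (Vec.fromList L) ≡ 0 →
                   StaysAbove (+ 0) (+ 0) (yCoords L)
RML≡0⇒StaysAbove L L⁺ rml≡0 with minSplitᴸ L
... | [] , W , refl , (_ , W>) = W>
... | U@((x , _) ∷ U′) , W , refl , atMin =
  ⊥-elim (ℕ.<⇒≢ (ℕ.<-≤-trans (All.head L⁺) (ℕ.m≤m+n x (width U′)))
                (trans (sym rml≡0) (MinSplit⇒RML≡width U W atMin)))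

-- The bijection

-- U ++ W becomes W ++ U, with the two runs meeting at the new seam fused and a final run 1 appended.
rotateFuse : List Step → List Step → List Step
rotateFuse U@((b , _) ∷ U′) W@((a , _) ∷ W′) =
  zip (fuse a (xCoords W′) b (xCoords U′) ++ 1 ∷ []) (yCoords (W ++ U))
rotateFuse U W = W ++ U

rotateAtMin : List Step → List Step
rotateAtMin L = Product.uncurry rotateFuse (cutAt (RML (Vec.fromList L)) L)

swap++ : List Step × List Step → List Step
swap++ (W , U) = U ++ W

unrotateAt : ℕ → List Step → List Step
unrotateAt c R = swap++ (cutAt c (zip (split c (init (xCoords R))) (yCoords R)))

rotateAtMin-++ : ∀ U W → MinSplit (+ 0) (yCoords U) (yCoords W) → Positive (xCoords U) →
                 rotateAtMin (U ++ W) ≡ rotateFuse U W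
rotateAtMin-++ U W atMin U⁺ rewrite MinSplit⇒RML≡width U W atMin | cutAt-++ U W U⁺ = refl

module Seam (a : ℕ) (y : ℤ) (W : List Step) (b : ℕ) (y′ : ℤ) (U : List Step) where

  Q R : List Step
  Q = (a , y) ∷ W ++ (b , y′) ∷ U
  R = rotateFuse ((b , y′) ∷ U) ((a , y) ∷ W)

  fused : List ℕ
  fused = fuse a (xCoords W) b (xCoords U)

  xCoords-Q : xCoords Q ≡ a ∷ xCoords W ++ b ∷ xCoords U
  xCoords-Q = cong (a ∷_) (List.map-++ proj₁ W ((b , y′) ∷ U))

  length-fused : length (fused ++ 1 ∷ []) ≡ length (yCoords Q)
  length-fused = begin
    length (fused ++ 1 ∷ [])                    ≡⟨ List.length-++-comm fused (1 ∷ []) ⟩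
    suc (length fused)                          ≡⟨ length-fuse a (xCoords W) b (xCoords U) ⟩
    length (a ∷ xCoords W ++ b ∷ xCoords U)     ≡⟨ cong length xCoords-Q ⟨
    length (xCoords Q)                          ≡⟨ List.length-map proj₁ Q ⟩
    length Q                                    ≡⟨ List.length-map proj₂ Q ⟨
    length (yCoords Q)                          ∎

  parts-positive : Positive (xCoords Q) →
                   Positive (xCoords ((a , y) ∷ W)) × Positive (xCoords ((b , y′) ∷ U))
  parts-positive Q⁺ =
    All.++⁻ (xCoords ((a , y) ∷ W)) (subst Positive (List.map-++ proj₁ ((a , y) ∷ W) ((b , y′) ∷ U)) Q⁺)

  xCoords-R : xCoords R ≡ fused ++ 1 ∷ []
  xCoords-R = xCoords-zip _ _ length-fused

  yCoords-R : yCoords R ≡ yCoords Q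
  yCoords-R = yCoords-zip _ _ length-fused

  length-R : length R ≡ length Q
  length-R = trans (sym (List.length-map proj₂ R)) (trans (cong length yCoords-R) (List.length-map proj₂ Q))

  width-R : Positive (xCoords Q) → width R ≡ width Q
  width-R Q⁺ = begin
    sum (xCoords R)                             ≡⟨ cong sum xCoords-R ⟩
    sum (fused ++ 1 ∷ [])                       ≡⟨ sum-++ fused (1 ∷ []) ⟩
    sum fused + 1                               ≡⟨ ℕ.+-comm (sum fused) 1 ⟩
    suc (sum fused)                             ≡⟨ sum-fuse a (xCoords W) b (xCoords U) Q⁺′ ⟩
    sum (a ∷ xCoords W ++ b ∷ xCoords U)        ≡⟨ cong sum xCoords-Q ⟨
    sum (xCoords Q)                             ∎
    where Q⁺′ = All.++⁻ˡ (a ∷ xCoords W) (subst Positive xCoords-Q Q⁺)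

  R-positive : Positive (xCoords Q) → Positive (xCoords R)
  R-positive Q⁺ = subst Positive (sym xCoords-R)
    (All.++⁺ (fuse-positive a (xCoords W) b (xCoords U) (subst Positive xCoords-Q Q⁺)) (s≤s z≤n ∷ []))

  unrotateAt-R : Positive (xCoords Q) → unrotateAt (width ((a , y) ∷ W)) R ≡ (b , y′) ∷ U ++ (a , y) ∷ W
  unrotateAt-R Q⁺ = begin
    swap++ (cutAt c (zip (split c (init (xCoords R))) (yCoords R)))
      ≡⟨ cong (λ X → swap++ (cutAt c (zip X (yCoords R)))) split≡ ⟩
    swap++ (cutAt c (zip (xCoords Q) (yCoords R)))
      ≡⟨ cong (λ Y → swap++ (cutAt c (zip (xCoords Q) Y))) yCoords-R ⟩
    swap++ (cutAt c (zip (xCoords Q) (yCoords Q)))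
      ≡⟨ cong (swap++ ∘ cutAt c) (zip-coords Q) ⟩
    swap++ (cutAt c Q)
      ≡⟨ cong swap++ (cutAt-++ ((a , y) ∷ W) ((b , y′) ∷ U) W⁺) ⟩
    (b , y′) ∷ U ++ (a , y) ∷ W
      ∎
    where
    c = width ((a , y) ∷ W)
    W⁺ = proj₁ (parts-positive Q⁺)
    Q⁺′ = subst Positive xCoords-Q Q⁺
    split≡ : split c (init (xCoords R)) ≡ xCoords Q
    split≡ = begin
      split c (init (xCoords R))                ≡⟨ cong (λ X → split c (init X)) xCoords-R ⟩
      split c (init (fused ++ 1 ∷ []))          ≡⟨ cong (split c) (init-∷ʳ fused 1) ⟩
      split c fused                             ≡⟨ split-fuse a (xCoords W) b (xCoords U) Q⁺′ ⟩
      a ∷ xCoords W ++ b ∷ xCoords U            ≡⟨ xCoords-Q ⟨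
      xCoords Q                                 ∎

  last-R : List.last (xCoords R) ≡ just 1
  last-R = trans (cong List.last xCoords-R) (last-∷ʳ fused 1)

  R-IsLatticePathᴸ : ∀ {n m} → 1 ≤ n → Positive (xCoords Q) →
                     IsLatticePathᴸ n m Q → IsLatticePathᴸ n m R
  R-IsLatticePathᴸ {n} {m} 1≤n Q⁺ (len , ok , rise≡ , width≡) =
    IsLatticePathᴸ-intro R 1≤n (trans length-R len) (R-positive Q⁺) (trans (width-R Q⁺) width≡)
      (subst (All (ValidRise n)) (sym yCoords-R) (proj₂ (coords-valid {n} {m} Q ok)))
      (trans (cong sumℤ yCoords-R) rise≡)

  Q-IsLatticePathᴸ : ∀ {n m} → 1 ≤ n → Positive (xCoords Q) →
                     IsLatticePathᴸ n m R → IsLatticePathᴸ n m Q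
  Q-IsLatticePathᴸ {n} {m} 1≤n Q⁺ (len , ok , rise≡ , width≡) =
    IsLatticePathᴸ-intro Q 1≤n (trans (sym length-R) len) Q⁺ (trans (sym (width-R Q⁺)) width≡)
      (subst (All (ValidRise n)) yCoords-R (proj₂ (coords-valid {n} {m} R ok)))
      (trans (cong sumℤ (sym yCoords-R)) rise≡)

record Seamed (c : ℕ) (R : List Step) : Set where
  field
    a : ℕ
    y : ℤ
    W : List Step
    b : ℕ
    y′ : ℤ
    U : List Step
    R≡ : R ≡ Seam.R a y W b y′ U
    width≡ : width ((a , y) ∷ W) ≡ c
    positive : Positive (xCoords (Seam.Q a y W b y′ U))

seamed : ∀ c R → 0 < c → c < width R → Positive (xCoords R) → List.last (xCoords R) ≡ just 1 →
         Seamed c R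
seamed c R 0<c c<width R⁺ last≡1 = fromFission (fission c X″ 0<c c≤ X″⁺)
  where
  X″ = init (xCoords R)
  xs≡ : X″ ++ 1 ∷ [] ≡ xCoords R
  xs≡ = init-∷ʳ-last (xCoords R) last≡1
  X″⁺ : Positive X″
  X″⁺ = All.++⁻ˡ X″ (subst Positive (sym xs≡) R⁺)
  c≤ : c ≤ sum X″
  c≤ = ℕ.≤-pred (subst (c <_) width≡ c<width)
    where
    width≡ : width R ≡ suc (sum X″)
    width≡ = trans (cong sum (sym xs≡)) (trans (sum-++ X″ (1 ∷ [])) (ℕ.+-comm (sum X″) 1))
  lengths : ∀ {a A b B} → fuse a A b B ≡ X″ → length (a ∷ A ++ b ∷ B) ≡ length (yCoords R)
  lengths {a} {A} {b} {B} fuse≡ = begin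
    length (a ∷ A ++ b ∷ B)       ≡⟨ length-fuse a A b B ⟨
    suc (length (fuse a A b B))   ≡⟨ cong (λ X → suc (length X)) fuse≡ ⟩
    suc (length X″)               ≡⟨ List.length-++-comm (1 ∷ []) X″ ⟩
    length (X″ ++ 1 ∷ [])         ≡⟨ cong length xs≡ ⟩
    length (xCoords R)            ≡⟨ List.length-map proj₁ R ⟩
    length R                      ≡⟨ List.length-map proj₂ R ⟨
    length (yCoords R)            ∎
  fromFission : Fission c X″ → Seamed c R
  fromFission record { a = a ; A = A ; b = b ; B = B ; width≡ = width≡ ; positive = positive ; fuse≡ = fuse≡ }
    with map-++⁻ proj₁ (zip (a ∷ A ++ b ∷ B) (yCoords R)) {a ∷ A} (xCoords-zip _ _ (lengths fuse≡))
  ... | (_ , y) ∷ W , (_ , y′) ∷ U , Q≡ , refl , refl = record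
    { R≡ = begin
        R                                                      ≡⟨ zip-coords R ⟨
        zip (xCoords R) (yCoords R)
          ≡⟨ cong₂ zip (trans (sym xs≡) (cong (_++ 1 ∷ []) (sym fuse≡))) ys≡ ⟩
        zip (fuse a A b B ++ 1 ∷ []) (yCoords (Seam.Q a y W b y′ U)) ∎
    ; width≡ = width≡
    ; positive = subst Positive (trans (sym (xCoords-zip _ _ (lengths fuse≡))) (cong xCoords Q≡)) positive
    }
    where
    ys≡ : yCoords R ≡ yCoords (Seam.Q a y W b y′ U)
    ys≡ = trans (sym (yCoords-zip _ _ (lengths fuse≡))) (cong yCoords Q≡)

WithRMLᴸ : ℕ → ℕ → ℕ → List Step → Set
WithRMLᴸ n m r L = IsLatticePathᴸ n m L × RML (Vec.fromList L) ≡ r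

WithRML0UnitLastᴸ : ℕ → ℕ → List Step → Set
WithRML0UnitLastᴸ n m R = IsLatticePathᴸ n m R × RML (Vec.fromList R) ≡ 0 × List.last (xCoords R) ≡ just 1

module Bijection {n m r : ℕ} (1≤n : 1 ≤ n) (1≤r : 1 ≤ r) (r≤m-1 : r ≤ m ∸ 1) where

  c : ℕ
  c = m ∸ r

  r<m : r < m
  r<m = <-from-≤pred m r≤m-1
    where
    <-from-≤pred : ∀ k → r ≤ pred k → r < k
    <-from-≤pred zero r≤0 = ⊥-elim (ℕ.<⇒≱ 1≤r r≤0)
    <-from-≤pred (suc k) r≤k = s≤s r≤k

  c-from-r : ∀ {u w} → u + w ≡ m → u ≡ r → w ≡ c
  c-from-r {u} {w} refl refl = sym (ℕ.m+n∸m≡n u w)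

  r-from-c : ∀ {u w} → u + w ≡ m → w ≡ c → u ≡ r
  r-from-c {u} {w} u+w≡m w≡c = begin
    u                ≡⟨ ℕ.m+n∸n≡m u w ⟨
    u + w ∸ w        ≡⟨ cong₂ _∸_ u+w≡m w≡c ⟩
    m ∸ (m ∸ r)      ≡⟨ ℕ.m∸[m∸n]≡n (ℕ.<⇒≤ r<m) ⟩
    r                ∎

  positive : ∀ L → All (StepOK n m) L → Positive (xCoords L)
  positive L ok = All.map proj₁ (proj₁ (coords-valid {n} {m} L ok))

  rotateAtMin-correct : ∀ L → WithRMLᴸ n m r L →
                        WithRML0UnitLastᴸ n m (rotateAtMin L) × unrotateAt c (rotateAtMin L) ≡ L
  rotateAtMin-correct L ((len , ok , rise≡ , width≡) , rml) with minSplitᴸ L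
  ... | [] , W , refl , atMin = ⊥-elim (ℕ.<⇒≢ 1≤r (trans (sym (MinSplit⇒RML≡width [] W atMin)) rml))
  ... | U , [] , refl , atMin =
    ⊥-elim (ℕ.<⇒≢ r<m (trans (sym rml) (trans (MinSplit⇒RML≡width U [] atMin)
                                               (trans (cong width (sym (List.++-identityʳ U))) width≡))))
  ... | U₀@((b , y′) ∷ U) , W₀@((a , y) ∷ W) , refl , atMin
    rewrite rotateAtMin-++ U₀ W₀ atMin (positive U₀ (All.++⁻ˡ U₀ ok)) =
    (R-IsLatticePathᴸ 1≤n Q⁺ Q-path , StaysAbove⇒RML≡0 R R> , last-R) ,
    subst (λ c′ → unrotateAt c′ R ≡ U₀ ++ W₀) width-W₀ (unrotateAt-R Q⁺)
    where
    open Seam a y W b y′ U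
    Q-path = IsLatticePathᴸ-swap U₀ W₀ (len , ok , rise≡ , width≡)
    Q⁺ = positive Q (proj₁ (proj₂ Q-path))
    R> : StaysAbove (+ 0) (+ 0) (yCoords R)
    R> = subst (StaysAbove (+ 0) (+ 0)) (sym (trans yCoords-R (List.map-++ proj₂ W₀ U₀)))
           (StaysAbove-rotate (yCoords U₀) (yCoords W₀) atMin
              (trans (cong sumℤ (sym (List.map-++ proj₂ U₀ W₀))) rise≡))
    width-W₀ : width W₀ ≡ c
    width-W₀ = c-from-r (trans (sym (width-++ U₀ W₀)) width≡)
                        (trans (sym (MinSplit⇒RML≡width U₀ W₀ atMin)) rml)

  unrotateAt-correct : ∀ R → WithRML0UnitLastᴸ n m R →
                       WithRMLᴸ n m r (unrotateAt c R) × rotateAtMin (unrotateAt c R) ≡ R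
  unrotateAt-correct R (R-path@(_ , R-ok , _ , R-width) , rml≡0 , last≡1)
    with seamed c R (ℕ.m<n⇒0<n∸m r<m) (subst (c <_) (sym R-width) (ℕ.∸-monoʳ-< 1≤r (ℕ.<⇒≤ r<m)))
                (positive R R-ok) last≡1
  ... | record { a = a ; y = y ; W = W ; b = b ; y′ = y′ ; U = U
               ; R≡ = refl ; width≡ = width≡ ; positive = Q⁺ }
    rewrite sym width≡ | Seam.unrotateAt-R a y W b y′ U Q⁺ =
    (UW-path , trans (MinSplit⇒RML≡width U₀ W₀ atMin) width-U₀) ,
    rotateAtMin-++ U₀ W₀ atMin (proj₂ (parts-positive Q⁺))
    where
    open Seam a y W b y′ U hiding (R)
    U₀ = (b , y′) ∷ U
    W₀ = (a , y) ∷ W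
    Q-path = Q-IsLatticePathᴸ 1≤n Q⁺ R-path
    UW-path = IsLatticePathᴸ-swap W₀ U₀ Q-path
    atMin : MinSplit (+ 0) (yCoords U₀) (yCoords W₀)
    atMin = MinSplit-rotate (yCoords U₀) y (yCoords W)
              (subst (StaysAbove (+ 0) (+ 0)) (trans yCoords-R (List.map-++ proj₂ W₀ U₀))
                     (RML≡0⇒StaysAbove R (positive R R-ok) rml≡0))
              (trans (cong sumℤ (sym (List.map-++ proj₂ W₀ U₀))) (proj₁ (proj₂ (proj₂ Q-path))))
    width-U₀ : width U₀ ≡ r
    width-U₀ = r-from-c (trans (sym (width-++ U₀ W₀)) (proj₂ (proj₂ (proj₂ UW-path)))) width≡

Σ-↔-irrelevant : ∀ {A B : Set} {P : A → Set} {Q : B → Set} → Irrelevant P → Irrelevant Q →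
                 (to : Σ A P → Σ B Q) (from : Σ B Q → Σ A P) →
                 (∀ x → proj₁ (from (to x)) ≡ proj₁ x) → (∀ y → proj₁ (to (from y)) ≡ proj₁ y) →
                 Σ A P ↔ Σ B Q
Σ-↔-irrelevant P-irr Q-irr to from from∘to to∘from =
  mk↔ₛ′ to from (λ y → Σ-≡,≡→≡ (to∘from y , Q-irr _ _))
                (λ x → Σ-≡,≡→≡ (from∘to x , P-irr _ _))

×-irrelevant : ∀ {A B : Set} → Nullary.Irrelevant A → Nullary.Irrelevant B → Nullary.Irrelevant (A × B)
×-irrelevant A-irr B-irr (a , b) (a′ , b′) = cong₂ _,_ (A-irr a a′) (B-irr b b′)

Finite : Set → Set
Finite A = ∃ (HasCard A)

↔-Finite : ∀ {A B : Set} → A ↔ B → Finite B → Finite A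
↔-Finite A↔B (k , B↔Fin) = k , ↔-trans A↔B B↔Fin

⊎-Finite : ∀ {A B : Set} → Finite A → Finite B → Finite (A ⊎ B)
⊎-Finite (k , A↔) (l , B↔) = k + l , ↔-trans (A↔ ⊎-↔ B↔) (↔-sym Fin.+↔⊎)

×-Finite : ∀ {A B : Set} → Finite A → Finite B → Finite (A × B)
×-Finite (k , A↔) (l , B↔) = k ℕ.* l , ↔-trans (A↔ ×-↔ B↔) (↔-sym Fin.*↔×)

Dec-Finite : ∀ {A : Set} → Dec A → Nullary.Irrelevant A → Finite A
Dec-Finite (yes a) irr = 1 , mk↔ₛ′ (λ _ → zero) (λ _ → a) (λ { zero → refl }) (irr a)
Dec-Finite (no ¬a) _ = 0 , mk↔ₛ′ (λ a → ⊥-elim (¬a a)) (λ ()) (λ ()) (λ a → ⊥-elim (¬a a))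

Fin-filter-Finite : ∀ N {P : Fin N → Set} → Decidable P → Irrelevant P → Finite (Σ (Fin N) P)
Fin-filter-Finite zero _ _ = 0 , mk↔ₛ′ (λ ()) (λ ()) (λ ()) (λ ())
Fin-filter-Finite (suc N) {P} P? P-irr =
  ↔-Finite Σ-Fin-suc (⊎-Finite (Dec-Finite (P? zero) P-irr) (Fin-filter-Finite N (P? ∘ suc) P-irr))
  where
  Σ-Fin-suc : Σ (Fin (suc N)) P ↔ (P zero ⊎ Σ (Fin N) (P ∘ suc))
  Σ-Fin-suc = mk↔ₛ′ (λ { (zero , p) → inj₁ p ; (suc i , p) → inj₂ (i , p) })
                    (λ { (inj₁ p) → zero , p ; (inj₂ (i , p)) → suc i , p })
                    (λ { (inj₁ _) → refl ; (inj₂ _) → refl })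
                    (λ { (zero , _) → refl ; (suc _ , _) → refl })

filter-Finite : ∀ {A : Set} {P : A → Set} {N} → A ↔ Fin N → Decidable P → Irrelevant P → Finite (Σ A P)
filter-Finite {P = P} A↔Fin P? P-irr =
  ↔-Finite (Σ-↔-irrelevant P-irr P-irr (Product.map to (subst P (sym (strictlyInverseʳ _))))
                                        (Product.map from id)
                                        (λ _ → strictlyInverseʳ _) (λ _ → strictlyInverseˡ _))
           (Fin-filter-Finite _ (P? ∘ from) P-irr)
  where open Inverse A↔Fin

bounded-Finite : ∀ K {P : ℕ → Set} → (∀ {x} → P x → x < K) → Decidable P → Irrelevant P →
                 Finite (Σ ℕ P)
bounded-Finite K {P} bound P? P-irr =
  ↔-Finite (Σ-↔-irrelevant P-irr P-irr
                            (λ (x , p) → fromℕ< (bound p) , subst P (sym (Fin.toℕ-fromℕ< _)) p)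
                                        (Product.map toℕ id)
                                        (λ _ → Fin.toℕ-fromℕ< _) (λ (i , _) → Fin.fromℕ<-toℕ i _))
           (Fin-filter-Finite K (P? ∘ toℕ) P-irr)

Vec↔List : ∀ {k} {P : Vec Step k → Set} {Q : List Step → Set} → Irrelevant P → Irrelevant Q →
           (∀ {v} → P v → Q (toList v)) → (∀ {v} → Q (toList v) → P v) → (∀ {L} → Q L → length L ≡ k) →
           Σ (Vec Step k) P ↔ Σ (List Step) Q
Vec↔List {Q = Q} P-irr Q-irr P⇒Q Q⇒P len =
  Σ-↔-irrelevant P-irr Q-irr (Product.map toList P⇒Q)
    (λ (L , q) → Vec.cast (len q) (Vec.fromList L) , Q⇒P (subst Q (sym (toList-fromList L q)) q))
    (λ (v , _) → Vec.fromList∘toList v) (λ (L , q) → toList-fromList L q)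
  where
  toList-fromList : ∀ L q → toList (Vec.cast (len q) (Vec.fromList L)) ≡ L
  toList-fromList L q = trans (Vec.toList-cast (len q) (Vec.fromList L)) (Vec.toList∘fromList L)

rise-toList : ∀ {k} (v : Vec Step k) → rise (toList v) ≡ sumY v
rise-toList [] = refl
rise-toList ((_ , y) ∷ v) = cong (λ s → y ℤ.+ s) (rise-toList v)

width-toList : ∀ {k} (v : Vec Step k) → width (toList v) ≡ sumX v
width-toList [] = refl
width-toList ((x , _) ∷ v) = cong (λ s → x + s) (width-toList v)

RML-toList : ∀ {k} (v : Vec Step k) → RML (Vec.fromList (toList v)) ≡ RML v
RML-toList v = cong (λ ps → rightmostAt (minHeight ps) ps) (pointsFrom-toList 0 (+ 0) v)
  where
  pointsFrom-toList : ∀ {k} b a (v : Vec Step k) → pointsFrom b a (Vec.fromList (toList v)) ≡ pointsFrom b a v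
  pointsFrom-toList b a [] = refl
  pointsFrom-toList b a ((x , y) ∷ v) = cong ((b , a) ∷_) (pointsFrom-toList (b + x) (a ℤ.+ y) v)

lastRun-toList : ∀ {k} (v : Vec Step (suc k)) → List.last (xCoords (toList v)) ≡ just (proj₁ (last v))
lastRun-toList v = trans (List.last-map proj₁ (toList v)) (cong (Maybe.map proj₁) (last-toList v))
  where
  last-toList : ∀ {k} (v : Vec Step (suc k)) → List.last (toList v) ≡ just (last v)
  last-toList (s ∷ []) = refl
  last-toList (s ∷ t ∷ v) = last-toList (t ∷ v)

toList-IsLatticePath : ∀ {n m} {v : Vec Step (suc n)} → IsLatticePath n m v → IsLatticePathᴸ n m (toList v)
toList-IsLatticePath {v = v} (ok , sumY≡ , sumX≡) =
  Vec.length-toList v , VecAll.toList⁺ ok , trans (rise-toList v) sumY≡ , trans (width-toList v) sumX≡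

IsLatticePath-toList : ∀ {n m} {v : Vec Step (suc n)} → IsLatticePathᴸ n m (toList v) → IsLatticePath n m v
IsLatticePath-toList {v = v} (_ , ok , rise≡ , width≡) =
  VecAll.toList⁻ ok , trans (sym (rise-toList v)) rise≡ , trans (sym (width-toList v)) width≡

ℤ-≡-irrelevant : ∀ {i j : ℤ} → Nullary.Irrelevant (i ≡ j)
ℤ-≡-irrelevant = Decidable⇒UIP.≡-irrelevant ℤ._≟_

Maybe-≡-irrelevant : ∀ {x y : Maybe ℕ} → Nullary.Irrelevant (x ≡ y)
Maybe-≡-irrelevant = Decidable⇒UIP.≡-irrelevant (Maybe.≡-dec ℕ._≟_)

StepOK-irrelevant : ∀ {n m} → Irrelevant (StepOK n m)
StepOK-irrelevant =
  ×-irrelevant (×-irrelevant ℕ.≤-irrelevant ℕ.≤-irrelevant) (×-irrelevant ℤ.≤-irrelevant ℤ.≤-irrelevant)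

IsLatticePath-irrelevant : ∀ {n m} → Irrelevant (IsLatticePath n m)
IsLatticePath-irrelevant {n} {m} =
  ×-irrelevant (VecAll.irrelevant (StepOK-irrelevant {n} {m})) (×-irrelevant ℤ-≡-irrelevant ℕ.≡-irrelevant)

IsLatticePathᴸ-irrelevant : ∀ {n m} → Irrelevant (IsLatticePathᴸ n m)
IsLatticePathᴸ-irrelevant {n} {m} =
  ×-irrelevant ℕ.≡-irrelevant
    (×-irrelevant (All.irrelevant (StepOK-irrelevant {n} {m})) (×-irrelevant ℤ-≡-irrelevant ℕ.≡-irrelevant))

WithRML : ∀ n → ℕ → ℕ → Vec Step (suc n) → Set
WithRML n m r P = IsLatticePath n m P × RML P ≡ r

WithRML0UnitLast : ∀ n → ℕ → Vec Step (suc n) → Set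
WithRML0UnitLast n m P = IsLatticePath n m P × RML P ≡ 0 × proj₁ (last P) ≡ 1

WithRML-irrelevant : ∀ {n m r} → Irrelevant (WithRML n m r)
WithRML-irrelevant = ×-irrelevant IsLatticePath-irrelevant ℕ.≡-irrelevant

WithRMLᴸ-irrelevant : ∀ {n m r} → Irrelevant (WithRMLᴸ n m r)
WithRMLᴸ-irrelevant = ×-irrelevant IsLatticePathᴸ-irrelevant ℕ.≡-irrelevant

WithRML0UnitLast-irrelevant : ∀ {n m} → Irrelevant (WithRML0UnitLast n m)
WithRML0UnitLast-irrelevant =
  ×-irrelevant IsLatticePath-irrelevant (×-irrelevant ℕ.≡-irrelevant ℕ.≡-irrelevant)

WithRML0UnitLastᴸ-irrelevant : ∀ {n m} → Irrelevant (WithRML0UnitLastᴸ n m)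
WithRML0UnitLastᴸ-irrelevant =
  ×-irrelevant IsLatticePathᴸ-irrelevant (×-irrelevant ℕ.≡-irrelevant Maybe-≡-irrelevant)

WithRML↔WithRMLᴸ : ∀ n m r → Σ (Vec Step (suc n)) (WithRML n m r) ↔ Σ (List Step) (WithRMLᴸ n m r)
WithRML↔WithRMLᴸ n m r =
  Vec↔List WithRML-irrelevant WithRMLᴸ-irrelevant
    (λ {v} (path , rml) → toList-IsLatticePath path , trans (RML-toList v) rml)
    (λ {v} (path , rml) → IsLatticePath-toList path , trans (sym (RML-toList v)) rml)
    (λ ((len , _) , _) → len)

WithRML0UnitLast↔WithRML0UnitLastᴸ : ∀ n m → Σ (Vec Step (suc n)) (WithRML0UnitLast n m)
                                           ↔ Σ (List Step) (WithRML0UnitLastᴸ n m)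
WithRML0UnitLast↔WithRML0UnitLastᴸ n m =
  Vec↔List WithRML0UnitLast-irrelevant WithRML0UnitLastᴸ-irrelevant
    (λ {v} (path , rml , last≡) → toList-IsLatticePath path , trans (RML-toList v) rml ,
                                  trans (lastRun-toList v) (cong just last≡))
    (λ {v} (path , rml , last≡) → IsLatticePath-toList path , trans (sym (RML-toList v)) rml ,
                                  Maybe.just-injective (trans (sym (lastRun-toList v)) last≡))
    (λ ((len , _) , _) → len)

WithRMLᴸ↔WithRML0UnitLastᴸ : ∀ {n m r} → 1 ≤ n → 1 ≤ r → r ≤ m ∸ 1 →
                             Σ (List Step) (WithRMLᴸ n m r) ↔ Σ (List Step) (WithRML0UnitLastᴸ n m)
WithRMLᴸ↔WithRML0UnitLastᴸ {n} {m} {r} 1≤n 1≤r r≤m-1 =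
  Σ-↔-irrelevant WithRMLᴸ-irrelevant WithRML0UnitLastᴸ-irrelevant
    (λ (L , φ) → rotateAtMin L , proj₁ (rotateAtMin-correct L φ))
    (λ (R , ψ) → unrotateAt c R , proj₁ (unrotateAt-correct R ψ))
    (λ (L , φ) → proj₂ (rotateAtMin-correct L φ)) (λ (R , ψ) → proj₂ (unrotateAt-correct R ψ))
  where open Bijection {n} {m} {r} 1≤n 1≤r r≤m-1

ValidRun-Finite : ∀ m → Finite (Σ ℕ (ValidRun m))
ValidRun-Finite m =
  bounded-Finite (suc (m ∸ 1)) (λ (_ , x≤) → s≤s x≤) (λ x → (1 ≤? x) ×-dec (x ≤? m ∸ 1))
                 (×-irrelevant ℕ.≤-irrelevant ℕ.≤-irrelevant)

ValidRise-Finite : ∀ n → Finite (Σ ℤ (ValidRise n))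
ValidRise-Finite n =
  ↔-Finite Σℤ↔⊎ (⊎-Finite (bounded-Finite 2 (λ { (_ , ℤ.+≤+ k≤1) → s≤s k≤1 }) (ValidRise? ∘ +_) irr)
                          (bounded-Finite n (negative<n n) (ValidRise? ∘ -[1+_]) irr))
  where
  ValidRise? : ∀ y → Dec (ValidRise n y)
  ValidRise? y = ((+ 1 ℤ.- + n) ℤ.≤? y) ×-dec (y ℤ.≤? + 1)
  irr : Irrelevant (ValidRise n)
  irr = ×-irrelevant ℤ.≤-irrelevant ℤ.≤-irrelevant
  negative<n : ∀ n {k} → ValidRise n -[1+ k ] → k < n
  negative<n (suc (suc n)) (ℤ.-≤- k≤n , _) = s≤s (ℕ.m≤n⇒m≤1+n k≤n)
  Σℤ↔⊎ : ∀ {P : ℤ → Set} → Σ ℤ P ↔ (Σ ℕ (P ∘ +_) ⊎ Σ ℕ (P ∘ -[1+_]))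
  Σℤ↔⊎ = mk↔ₛ′ (λ { (+ k , p) → inj₁ (k , p) ; (-[1+ k ] , p) → inj₂ (k , p) })
               (λ { (inj₁ (k , p)) → + k , p ; (inj₂ (k , p)) → -[1+ k ] , p })
               (λ { (inj₁ _) → refl ; (inj₂ _) → refl })
               (λ { (+ _ , _) → refl ; (-[1+ _ ] , _) → refl })

StepOK-Finite : ∀ n m → Finite (Σ Step (StepOK n m))
StepOK-Finite n m = ↔-Finite (mk↔ₛ′ (λ ((x , y) , x-ok , y-ok) → (x , x-ok) , (y , y-ok))
                                    (λ ((x , x-ok) , (y , y-ok)) → (x , y) , x-ok , y-ok)
                                    (λ _ → refl) (λ _ → refl))
                             (×-Finite (ValidRun-Finite m) (ValidRise-Finite n))

StepOK-Vec-Finite : ∀ n m k → Finite (Σ (Vec Step k) (VecAll.All (StepOK n m)))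
StepOK-Vec-Finite n m zero =
  1 , mk↔ₛ′ (λ _ → zero) (λ _ → [] , VecAll.[]) (λ { zero → refl }) (λ { ([] , VecAll.[]) → refl })
StepOK-Vec-Finite n m (suc k) =
  ↔-Finite (mk↔ₛ′ (λ { (s ∷ v , ok VecAll.∷ oks) → (s , ok) , (v , oks) })
                  (λ ((s , ok) , (v , oks)) → s ∷ v , ok VecAll.∷ oks)
                  (λ _ → refl) (λ { (_ ∷ _ , _ VecAll.∷ _) → refl }))
           (×-Finite (StepOK-Finite n m) (StepOK-Vec-Finite n m k))

WithRML0UnitLast-Finite : ∀ n m → Finite (Σ (Vec Step (suc n)) (WithRML0UnitLast n m))
WithRML0UnitLast-Finite n m =
  ↔-Finite (mk↔ₛ′ (λ (P , (ok , rest) , rml , last≡) → (P , ok) , rest , rml , last≡)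
                  (λ ((P , ok) , rest , rml , last≡) → P , (ok , rest) , rml , last≡)
                  (λ _ → refl) (λ _ → refl))
           (filter-Finite (proj₂ (StepOK-Vec-Finite n m (suc n)))
              (λ (P , _) → ((sumY P ℤ.≟ + 1) ×-dec (sumX P ℕ.≟ m)) ×-dec (RML P ℕ.≟ 0)
                                                                ×-dec (proj₁ (last P) ℕ.≟ 1))
              (×-irrelevant (×-irrelevant ℤ-≡-irrelevant ℕ.≡-irrelevant)
                            (×-irrelevant ℕ.≡-irrelevant ℕ.≡-irrelevant)))

-- The hypothesis n + 1 ≤ m is unused: for m ≤ n both sets are empty anyway.
theorem2p12 : (n m : ℕ) → 1 ≤ n → n + 1 ≤ m → (r : ℕ) → 1 ≤ r → r ≤ m ∸ 1 →
    ∃ λ (k : ℕ) →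
      HasCard (Σ (Vec Step (suc n)) λ P → IsLatticePath n m P × RML P ≡ r) k
      × HasCard (Σ (Vec Step (suc n)) λ P → IsLatticePath n m P × RML P ≡ 0 × proj₁ (last P) ≡ 1) k
theorem2p12 n m 1≤n _ r 1≤r r≤m-1 = k , ↔-trans A↔B B↔Fin , B↔Fin
  where
  k = proj₁ (WithRML0UnitLast-Finite n m)
  B↔Fin = proj₂ (WithRML0UnitLast-Finite n m)
  A↔B = ↔-trans (WithRML↔WithRMLᴸ n m r)
        (↔-trans (WithRMLᴸ↔WithRML0UnitLastᴸ 1≤n 1≤r r≤m-1)
                 (↔-sym (WithRML0UnitLast↔WithRML0UnitLastᴸ n m)))
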